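{- Every rigid graph $G$ with $|E(G)|\ge 2(|V(G)|-1)$ has $2$ edge-disjoint spanning trees.
   Context: Graphs may have multiple edges but no loops. For $X\subseteq V(H)$, $i_H(X)$ is the number of edges of $H[X]$; $H$ is sparse if $i_H(X)\le 2|X|-3$ for all $X$ with $|X|\ge 2$, minimally rigid if additionally $|E(H)|=2|V(H)|-3$, and rigid if it contains a spanning minimally rigid subgraph. -}

module Defs where

open import Data.Nat using (ℕ; zero; suc; _+_; _*_; _∸_; _≤_; _≥_)
open import Data.Fin using (Fin; zero; suc; inject₁; fromℕ)
open import Data.Fin.Subset using (Subset; _∈_; _∉_; _∩_; ∣_∣; Empty)
open import Data.Vec using (tabulate; lookup)
open import Data.Bool using (_∧_)
open import Data.Product using (_×_; _,_; proj₁; proj₂; Σ; ∃)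
open import Data.Sum using (_⊎_)
open import Relation.Binary.PropositionalEquality using (_≡_; _≢_)
open import Relation.Nullary using (¬_)
open import Function.Definitions using (Injective)

-- A finite multigraph without loops on vertex set Fin n with edge set Fin m.
-- Edge e joins the vertices ends e = (u , v); parallel edges are allowed.
record Graph (n m : ℕ) : Set where
  field
    ends   : Fin m → Fin n × Fin n
    noLoop : ∀ e → proj₁ (ends e) ≢ proj₂ (ends e)
open Graph public

module _ {n m : ℕ} (G : Graph n m) where

  Joins : Fin m → Fin n → Fin n → Set
  Joins e u v = ends G e ≡ (u , v) ⊎ ends G e ≡ (v , u)

  inducedEdges : Subset n → Subset m
  inducedEdges X = tabulate λ e →
    lookup X (proj₁ (ends G e)) ∧ lookup X (proj₂ (ends G e))

  iSub : Subset m → Subset n → ℕ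
  iSub F X = ∣ F ∩ inducedEdges X ∣

  Sparse : Subset m → Set
  Sparse F = ∀ (X : Subset n) → ∣ X ∣ ≥ 2 → iSub F X ≤ 2 * ∣ X ∣ ∸ 3

  MinimallyRigid : Subset m → Set
  MinimallyRigid F = Sparse F × ∣ F ∣ ≡ 2 * n ∸ 3

  Rigid : Set
  Rigid = Σ (Subset m) MinimallyRigid

  data Walk (F : Subset m) : Fin n → Fin n → Set where
    nil  : ∀ {u} → Walk F u u
    cons : ∀ {u w v} (e : Fin m) → e ∈ F → Joins e u w → Walk F w v → Walk F u v

  Connected : Subset m → Set
  Connected F = ∀ u v → Walk F u v

  record Cycle (F : Subset m) : Set where
    field
      k       : ℕ
      k≥2     : k ≥ 2
      vs      : Fin (suc k) → Fin n
      es      : Fin k → Fin m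
      closed  : vs zero ≡ vs (fromℕ k)
      vsInj   : Injective _≡_ _≡_ (λ i → vs (inject₁ i))
      esInj   : Injective _≡_ _≡_ es
      esIn    : ∀ i → es i ∈ F
      esJoin  : ∀ i → Joins (es i) (vs (inject₁ i)) (vs (suc i))

  Acyclic : Subset m → Set
  Acyclic F = ¬ Cycle F

  SpanningTree : Subset m → Set
  SpanningTree T = Connected T × Acyclic T

  Disjoint : Subset m → Subset m → Set
  Disjoint S T = Empty (S ∩ T)

module Submission where

open import Defs
open import Data.Nat using (ℕ; _*_; _∸_; _≥_)
open import Data.Fin.Subset using (Subset)
open import Data.Product using (Σ; _×_)

open import Data.Nat using (zero; suc; _+_; _≤_; _<_; z≤n; s≤s; _≤?_)
open import Data.Nat.Properties
  using ( ≤-refl; ≤-reflexive; ≤-trans; ≤-pred; <⇒≱; ≰⇒>; n≤0⇒n≡0; n≤1+n; m≤m+n; m≤n+m; m+1+n≰m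
        ; +-comm; +-suc; +-identityʳ; +-mono-≤; +-monoˡ-≤; +-monoʳ-≤; +-cancelʳ-≤; m+[n∸m]≡n
        ; *-assoc; *-suc; *-distribˡ-+; *-monoʳ-≤; suc-injective; 0≢1+n
        ; +-commutativeSemigroup; +-*-semiring; module ≤-Reasoning )
open import Data.Nat.Solver using (module +-*-Solver)
open import Data.Fin using (Fin; zero; suc; _≟_; inject₁; fromℕ)
import Data.Fin.Properties as Finₚ
open import Data.Fin.Properties using (any?)
open import Data.Fin.Subset using (∣_∣) renaming (⊥ to ∅)
open import Data.Fin.Subset.Properties using (anySubset?; ∉⊥; x∈p∩q⁻)
open import Data.Bool using (Bool; true; false; _∧_; _∨_; not; if_then_else_)
import Data.Bool as Bool
open import Data.Bool.Properties
  using (∧-zeroʳ; ∧-identityʳ; ∨-zeroʳ; ∨-identityʳ; ∧-comm; ∧-conicalˡ; ∧-conicalʳ; ¬-not; not-¬)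
open import Data.Maybe using (Maybe; just; nothing)
open import Data.Product using (_,_; proj₁; proj₂)
open import Data.Sum using (_⊎_; inj₁; inj₂)
open import Data.Empty using (⊥; ⊥-elim)
import Data.Vec as Vec
open import Data.Vec using (lookup; tabulate)
open import Data.Vec.Properties using (lookup∘tabulate; lookup-zipWith; lookup-replicate; []=⇒lookup; lookup⇒[]=)
open import Data.Vec.Functional using (_∷_)
open import Function using (_∘_; id)
open import Relation.Binary.PropositionalEquality
open import Relation.Nullary using (Dec; yes; no; does)
open import Relation.Nullary.Decidable using (dec-true; dec-false; _×-dec_; ¬?)
open import Algebra.Properties.CommutativeSemigroup +-commutativeSemigroup using (x∙yz≈y∙xz)
open import Algebra.Properties.Semiring.Sum +-*-semiring using (sum; sum-cong-≗; ∑-distrib-+; ∑-comm; *-distribˡ-sum)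

-- Let F be a spanning minimally rigid edge set: |F| = 2n − 3 and
-- i_F(X) ≤ 2|X| − 3 for |X| ≥ 2.  For n ≤ 1 both trees are empty.  Otherwise
-- m ≥ 2n − 2 > |F| yields an edge e₀ ∉ F, and H = F + e₀ has 2n − 2 edges and
-- is (2,2)-sparse: i(X) ≤ 2|X| − 2 for X ≠ ∅.  By Nash-Williams' theorem for
-- two forests (two-forests) H splits into two (1,1)-sparse edge sets; each
-- has at most n − 1 edges, so both have exactly n − 1 and are spanning trees
-- (spanning-tree).  two-forests goes by induction on the number of edges,
-- at a vertex of degree 1, 2 or 3 (handshake lemma): its edges are removed,
-- or for degree 3 replaced by an edge between two neighbours that keeps the
-- graph (2,2)-sparse, and put back as pendant edges or by subdivision.

bit : Bool → ℕ
bit true  = 1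
bit false = 0

count : ∀ {k} → (Fin k → Bool) → ℕ
count P = sum (λ i → bit (P i))

false≢true : false ≢ true
false≢true ()

_[_≔_] : ∀ {k} {A : Set} → (Fin k → A) → Fin k → A → Fin k → A
(f [ j ≔ x ]) i = if does (i ≟ j) then x else f i

update-at : ∀ {k} {A : Set} (f : Fin k → A) j x → (f [ j ≔ x ]) j ≡ x
update-at f j x rewrite dec-true (j ≟ j) refl = refl

update-other : ∀ {k} {A : Set} (f : Fin k → A) {j i} x → i ≢ j → (f [ j ≔ x ]) i ≡ f i
update-other f {j} {i} x i≢j rewrite dec-false (i ≟ j) i≢j = refl

⁅_⁆ : ∀ {k} → Fin k → Fin k → Bool
⁅ p ⁆ u = does (p ≟ u)

sum-mono : ∀ {k} {f g : Fin k → ℕ} → (∀ i → f i ≤ g i) → sum f ≤ sum g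
sum-mono {zero}  f≤g = z≤n
sum-mono {suc k} f≤g = +-mono-≤ (f≤g zero) (sum-mono (f≤g ∘ suc))

sum-split : ∀ {k} (f : Fin k → ℕ) j → sum f ≡ f j + sum (f [ j ≔ 0 ])
sum-split f zero = refl
sum-split f (suc j) = begin
  f zero + sum (f ∘ suc)                            ≡⟨ cong (f zero +_) (sum-split (f ∘ suc) j) ⟩
  f zero + (f (suc j) + sum ((f ∘ suc) [ j ≔ 0 ]))  ≡⟨ x∙yz≈y∙xz (f zero) (f (suc j)) _ ⟩
  f (suc j) + (f zero + sum ((f ∘ suc) [ j ≔ 0 ]))  ∎
  where open ≡-Reasoning

count-cong : ∀ {k} {P Q : Fin k → Bool} → (∀ i → P i ≡ Q i) → count P ≡ count Q
count-cong P≗Q = sum-cong-≗ (cong bit ∘ P≗Q)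

count-mono : ∀ {k} (P Q : Fin k → Bool) → (∀ i → P i ≡ true → Q i ≡ true) → count P ≤ count Q
count-mono P Q P⊆Q = sum-mono bit-mono
  where
  bit-mono : ∀ i → bit (P i) ≤ bit (Q i)
  bit-mono i with P i in Pi
  ... | false = z≤n
  ... | true rewrite P⊆Q i Pi = ≤-refl

count-split : ∀ {k} (P : Fin k → Bool) j → count P ≡ bit (P j) + count (P [ j ≔ false ])
count-split P j = trans (sum-split (bit ∘ P) j) (cong (bit (P j) +_) (sum-cong-≗ bit-update))
  where
  bit-update : ∀ i → ((bit ∘ P) [ j ≔ 0 ]) i ≡ bit ((P [ j ≔ false ]) i)
  bit-update i with does (i ≟ j)
  ... | true  = refl
  ... | false = refl

count-insert : ∀ {k} (P : Fin k → Bool) j → P j ≡ false → count (P [ j ≔ true ]) ≡ suc (count P)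
count-insert P j Pj rewrite count-split (P [ j ≔ true ]) j | count-split P j | update-at P j true | Pj =
  cong suc (count-cong same)
  where
  same : ∀ i → ((P [ j ≔ true ]) [ j ≔ false ]) i ≡ (P [ j ≔ false ]) i
  same i with does (i ≟ j)
  ... | true  = refl
  ... | false = refl

count-empty : ∀ {k} (P : Fin k → Bool) → (∀ i → P i ≡ false) → count P ≡ 0
count-empty {zero}  P _ = refl
count-empty {suc k} P P≗∅ rewrite P≗∅ zero = count-empty (P ∘ suc) (P≗∅ ∘ suc)

count-pos : ∀ {k} (P : Fin k → Bool) j → P j ≡ true → 1 ≤ count P
count-pos P j Pj rewrite count-split P j | Pj = s≤s z≤n

count-zero : ∀ {k} (P : Fin k → Bool) → count P ≡ 0 → ∀ j → P j ≡ false
count-zero P #P≡0 j with P j in Pj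
... | false = refl
... | true  = ⊥-elim (<⇒≱ (count-pos P j Pj) (≤-reflexive #P≡0))

count-all : ∀ {k} → count {k} (λ _ → true) ≡ k
count-all {zero}  = refl
count-all {suc k} = cong suc (count-all {k})

count≤n : ∀ {k} (P : Fin k → Bool) → count P ≤ k
count≤n P = subst (count P ≤_) count-all (count-mono P (λ _ → true) (λ _ _ → refl))

count-complement : ∀ {k} (P : Fin k → Bool) → count P + count (not ∘ P) ≡ k
count-complement {k} P = begin
  count P + count (not ∘ P)         ≡⟨ ∑-distrib-+ (bit ∘ P) (bit ∘ not ∘ P) ⟨
  sum (λ i → bit (P i) + bit (not (P i))) ≡⟨ sum-cong-≗ (bit-complement ∘ P) ⟩
  count {k} (λ _ → true)             ≡⟨ count-all ⟩
  k                                 ∎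
  where
  open ≡-Reasoning
  bit-complement : ∀ b → bit b + bit (not b) ≡ 1
  bit-complement true  = refl
  bit-complement false = refl

count-singleton : ∀ {k} (p : Fin k) → count ⁅ p ⁆ ≡ 1
count-singleton p rewrite count-split ⁅ p ⁆ p | dec-true (p ≟ p) refl =
  cong suc (count-empty _ only-p)
  where
  only-p : ∀ i → (⁅ p ⁆ [ p ≔ false ]) i ≡ false
  only-p i with i ≟ p
  ... | yes _  = refl
  ... | no i≢p = dec-false (p ≟ i) (i≢p ∘ sym)

count-∨∧ : ∀ {k} (P Q : Fin k → Bool) →
  count (λ i → P i ∨ Q i) + count (λ i → P i ∧ Q i) ≡ count P + count Q
count-∨∧ P Q = begin
  count (λ i → P i ∨ Q i) + count (λ i → P i ∧ Q i)
    ≡⟨ ∑-distrib-+ (λ i → bit (P i ∨ Q i)) (λ i → bit (P i ∧ Q i)) ⟨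
  sum (λ i → bit (P i ∨ Q i) + bit (P i ∧ Q i))
    ≡⟨ sum-cong-≗ (λ i → bit-∨∧ (P i) (Q i)) ⟩
  sum (λ i → bit (P i) + bit (Q i))
    ≡⟨ ∑-distrib-+ (bit ∘ P) (bit ∘ Q) ⟩
  count P + count Q ∎
  where
  open ≡-Reasoning
  bit-∨∧ : ∀ a b → bit (a ∨ b) + bit (a ∧ b) ≡ bit a + bit b
  bit-∨∧ true  true  = refl
  bit-∨∧ true  false = refl
  bit-∨∧ false true  = refl
  bit-∨∧ false false = refl

count-two : ∀ {k} (P : Fin k → Bool) {a b} → a ≢ b → P a ≡ true → P b ≡ true → 2 ≤ count P
count-two P {a} {b} a≢b Pa Pb rewrite count-split P a | Pa =
  s≤s (count-pos (P [ a ≔ false ]) b (trans (update-other P false (a≢b ∘ sym)) Pb))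

count-injection : ∀ {k l} (f : Fin k → Fin l) → (∀ {i j} → f i ≡ f j → i ≡ j) →
  (Q : Fin l → Bool) → (∀ i → Q (f i) ≡ true) → k ≤ count Q
count-injection {zero}  f f-inj Q f⊆Q = z≤n
count-injection {suc k} f f-inj Q f⊆Q rewrite count-split Q (f zero) | f⊆Q zero =
  s≤s (count-injection (f ∘ suc) (Finₚ.suc-injective ∘ f-inj) (Q [ f zero ≔ false ]) rest⊆)
  where
  rest⊆ : ∀ i → (Q [ f zero ≔ false ]) (f (suc i)) ≡ true
  rest⊆ i = trans (update-other Q false (λ eq → Finₚ.0≢1+n (sym (f-inj eq)))) (f⊆Q (suc i))

image : ∀ {k l} → (Fin k → Fin l) → Fin l → Bool
image {zero}  f u = false
image {suc k} f u = ⁅ f zero ⁆ u ∨ image (f ∘ suc) u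

image-∋ : ∀ {k l} (f : Fin k → Fin l) i → image f (f i) ≡ true
image-∋ f zero rewrite dec-true (f zero ≟ f zero) refl = refl
image-∋ f (suc i) rewrite image-∋ (f ∘ suc) i = ∨-zeroʳ _

count-image : ∀ {k l} (f : Fin k → Fin l) → count (image f) ≤ k
count-image {zero}  {l} f = ≤-reflexive (count-empty {l} (λ _ → false) (λ _ → refl))
count-image {suc k} f = begin
  count (image f)
    ≤⟨ m≤m+n (count (image f)) _ ⟩
  count (image f) + count (λ u → ⁅ f zero ⁆ u ∧ image (f ∘ suc) u)
    ≡⟨ count-∨∧ ⁅ f zero ⁆ (image (f ∘ suc)) ⟩
  count ⁅ f zero ⁆ + count (image (f ∘ suc))
    ≡⟨ cong (_+ count (image (f ∘ suc))) (count-singleton (f zero)) ⟩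
  suc (count (image (f ∘ suc)))
    ≤⟨ s≤s (count-image (f ∘ suc)) ⟩
  suc k ∎
  where open ≤-Reasoning

image-nonempty : ∀ {k l} (f : Fin k → Fin l) → 1 ≤ k → 1 ≤ count (image f)
image-nonempty {suc k} f _ = count-pos (image f) (f zero) (image-∋ f zero)

module Multigraph (N : ℕ) where

  -- Multigraphs on the vertex set V = Fin N, presented by k edge slots,
  -- each empty or holding an edge; vertex sets are Boolean predicates.
  V : Set
  V = Fin N

  Edge : Set
  Edge = V × V

  VSet : Set
  VSet = V → Bool

  Slots : ℕ → Set
  Slots k = Fin k → Maybe Edge

  spans : VSet → Maybe Edge → Bool
  spans X nothing        = false
  spans X (just (p , q)) = X p ∧ X q

  induced : ∀ {k} → Slots k → VSet → ℕ
  induced H X = count (λ j → spans X (H j))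

  allV : VSet
  allV _ = true

  size : ∀ {k} → Slots k → ℕ
  size H = induced H allV

  _─_ : VSet → V → VSet
  (X ─ v) u = X u ∧ not (⁅ u ⁆ v)

  touches : V → Maybe Edge → Bool
  touches v e = spans allV e ∧ not (spans (allV ─ v) e)

  deg : ∀ {k} → V → Slots k → ℕ
  deg v H = count (λ j → touches v (H j))

  Isolated : ∀ {k} → V → Slots k → Set
  Isolated v H = ∀ j → touches v (H j) ≡ false

  -- (1,1)-sparse: i(X) ≤ |X| − 1 for nonempty X (the counting form of a forest);
  -- (2,2)-sparse: i(X) ≤ 2|X| − 2 for nonempty X.
  Sparse₁₁ : ∀ {k} → Slots k → Set
  Sparse₁₁ H = ∀ X → 1 ≤ count X → induced H X + 1 ≤ count X

  Sparse₂₂ : ∀ {k} → Slots k → Set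
  Sparse₂₂ H = ∀ X → 1 ≤ count X → induced H X + 2 ≤ 2 * count X

  -- Two slot lists are equivalent when they hold the same edges slot by
  -- slot, up to orientation; all notions above are invariant under this.
  record _≅_ {k} (H H′ : Slots k) : Set where
    constructor ≅-intro
    field spans-≡ : ∀ j X → spans X (H j) ≡ spans X (H′ j)
  open _≅_ public

  record _⊑_ {k k′} (H : Slots k) (H′ : Slots k′) : Set where
    constructor ⊑-intro
    field induced-≤ : ∀ X → induced H X ≤ induced H′ X
  open _⊑_ public

  module _ {k : ℕ} where

    ≅-pointwise : {H H′ : Slots k} → (∀ j → H j ≡ H′ j) → H ≅ H′
    ≅-pointwise H≗H′ = ≅-intro (λ j X → cong (spans X) (H≗H′ j))

    ≅-trans : {H H′ H″ : Slots k} → H ≅ H′ → H′ ≅ H″ → H ≅ H″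
    ≅-trans H≅H′ H′≅H″ = ≅-intro (λ j X → trans (spans-≡ H≅H′ j X) (spans-≡ H′≅H″ j X))

    induced-≅ : {H H′ : Slots k} → H ≅ H′ → ∀ X → induced H X ≡ induced H′ X
    induced-≅ H≅H′ X = count-cong (λ j → spans-≡ H≅H′ j X)

    ≅⇒⊑ : {H H′ : Slots k} → H ≅ H′ → H ⊑ H′
    ≅⇒⊑ H≅H′ = ⊑-intro (λ X → ≤-reflexive (induced-≅ H≅H′ X))

    ⊑-slotwise : (H H′ : Slots k) → (∀ j X → spans X (H j) ≡ true → spans X (H′ j) ≡ true) → H ⊑ H′
    ⊑-slotwise H H′ H⊆H′ = ⊑-intro (λ X → count-mono _ _ (λ j → H⊆H′ j X))

    Sparse₁₁-⊑ : ∀ {k′} {H : Slots k} {H′ : Slots k′} → H ⊑ H′ → Sparse₁₁ H′ → Sparse₁₁ H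
    Sparse₁₁-⊑ H⊑H′ sparse X X≢∅ = ≤-trans (+-monoˡ-≤ 1 (induced-≤ H⊑H′ X)) (sparse X X≢∅)

    Sparse₂₂-⊑ : ∀ {k′} {H : Slots k} {H′ : Slots k′} → H ⊑ H′ → Sparse₂₂ H′ → Sparse₂₂ H
    Sparse₂₂-⊑ H⊑H′ sparse X X≢∅ = ≤-trans (+-monoˡ-≤ 2 (induced-≤ H⊑H′ X)) (sparse X X≢∅)

    Isolated-≅ : ∀ {v} {H H′ : Slots k} → H ≅ H′ → Isolated v H′ → Isolated v H
    Isolated-≅ {v} H≅H′ iso j =
      trans (cong₂ (λ s t → s ∧ not t) (spans-≡ H≅H′ j allV) (spans-≡ H≅H′ j (allV ─ v))) (iso j)

    induced-cong : (H : Slots k) {X Y : VSet} → (∀ u → X u ≡ Y u) → induced H X ≡ induced H Y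
    induced-cong H {X} {Y} X≗Y = count-cong (λ j → spans-cong (H j))
      where
      spans-cong : ∀ e → spans X e ≡ spans Y e
      spans-cong nothing        = refl
      spans-cong (just (p , q)) = cong₂ _∧_ (X≗Y p) (X≗Y q)

    induced≤size : ∀ (H : Slots k) X → induced H X ≤ size H
    induced≤size H X = count-mono _ _ (λ j → spans⊆all (H j))
      where
      spans⊆all : ∀ e → spans X e ≡ true → spans allV e ≡ true
      spans⊆all (just _) _ = refl

    edgeless-forest : ∀ (H : Slots k) → size H ≡ 0 → Sparse₁₁ H
    edgeless-forest H size≡0 X X≢∅ =
      ≤-trans (+-monoˡ-≤ 1 (≤-trans (induced≤size H X) (≤-reflexive size≡0))) X≢∅

    induced-∅ : ∀ (H : Slots k) X → count X ≡ 0 → induced H X ≡ 0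
    induced-∅ H X #X≡0 = count-empty _ (λ j → spans-∅ (H j))
      where
      spans-∅ : ∀ e → spans X e ≡ false
      spans-∅ nothing        = refl
      spans-∅ (just (p , _)) rewrite count-zero X #X≡0 p = refl

    ins : Fin k → Edge → Slots k → Slots k
    ins j e H = H [ j ≔ just e ]

    del : Fin k → Slots k → Slots k
    del j H = H [ j ≔ nothing ]

    induced-ins : ∀ j e (H : Slots k) → H j ≡ nothing → ∀ X →
      induced (ins j e H) X ≡ bit (spans X (just e)) + induced H X
    induced-ins j e H Hj≡∅ X =
      trans (count-split _ j) (cong₂ _+_ (cong (bit ∘ spans X) (update-at H j (just e))) (count-cong rest))
      where
      rest : ∀ i → ((λ i → spans X (ins j e H i)) [ j ≔ false ]) i ≡ spans X (H i)
      rest i with i ≟ j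
      ... | yes refl = cong (spans X) (sym Hj≡∅)
      ... | no _     = refl

    count-del : ∀ (g : Maybe Edge → Bool) → g nothing ≡ false → ∀ (H : Slots k) j →
      count (g ∘ H) ≡ bit (g (H j)) + count (g ∘ del j H)
    count-del g g∅ H j = trans (count-split _ j) (cong (bit (g (H j)) +_) (count-cong rest))
      where
      rest : ∀ i → ((g ∘ H) [ j ≔ false ]) i ≡ g (del j H i)
      rest i with does (i ≟ j)
      ... | true  = sym g∅
      ... | false = refl

    induced-del : ∀ (H : Slots k) j X → induced H X ≡ bit (spans X (H j)) + induced (del j H) X
    induced-del H j X = count-del (spans X) refl H j

    del-⊑ : ∀ (H : Slots k) j → del j H ⊑ H
    del-⊑ H j = ⊑-intro (λ X → subst (induced (del j H) X ≤_) (sym (induced-del H j X)) (m≤n+m _ _))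

    ins-≅ : ∀ j e {H H′ : Slots k} → H ≅ H′ → ins j e H ≅ ins j e H′
    ins-≅ j e {H} {H′} H≅H′ = ≅-intro slotwise
      where
      slotwise : ∀ i X → spans X (ins j e H i) ≡ spans X (ins j e H′ i)
      slotwise i X with does (i ≟ j)
      ... | true  = refl
      ... | false = spans-≡ H≅H′ i X

    ins-swap : ∀ {j j′} e e′ (H : Slots k) → j ≢ j′ → ins j e (ins j′ e′ H) ≅ ins j′ e′ (ins j e H)
    ins-swap {j} {j′} e e′ H j≢j′ = ≅-pointwise slotwise
      where
      slotwise : ∀ i → ins j e (ins j′ e′ H) i ≡ ins j′ e′ (ins j e H) i
      slotwise i with i ≟ j | i ≟ j′
      ... | yes refl | yes refl = ⊥-elim (j≢j′ refl)
      ... | yes _    | no _     = refl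
      ... | no _     | yes _    = refl
      ... | no _     | no _     = refl

    colour : (Fin k → Bool) → Bool → Slots k → Slots k
    colour c b H j = if does (c j Bool.≟ b) then H j else nothing

    colour-≅ : ∀ c b {H H′ : Slots k} → H ≅ H′ → colour c b H ≅ colour c b H′
    colour-≅ c b {H} {H′} H≅H′ = ≅-intro slotwise
      where
      slotwise : ∀ j X → spans X (colour c b H j) ≡ spans X (colour c b H′ j)
      slotwise j X with does (c j Bool.≟ b)
      ... | true  = spans-≡ H≅H′ j X
      ... | false = refl

    colour-⊑ : ∀ c b (H : Slots k) → colour c b H ⊑ H
    colour-⊑ c b H = ⊑-slotwise (colour c b H) H slotwise
      where
      slotwise : ∀ j X → spans X (colour c b H j) ≡ true → spans X (H j) ≡ true
      slotwise j X with does (c j Bool.≟ b)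
      ... | true  = id
      ... | false = λ ()

    colour-split : ∀ c (H : Slots k) X →
      induced (colour c true H) X + induced (colour c false H) X ≡ induced H X
    colour-split c H X =
      trans (sym (∑-distrib-+ (bit ∘ spans X ∘ colour c true H) (bit ∘ spans X ∘ colour c false H)))
            (sum-cong-≗ slotwise)
      where
      slotwise : ∀ j → bit (spans X (colour c true H j)) + bit (spans X (colour c false H j)) ≡ bit (spans X (H j))
      slotwise j with c j
      ... | true  = +-identityʳ _
      ... | false = refl

    colour-ins-same : ∀ c b j e (H : Slots k) → colour (c [ j ≔ b ]) b (ins j e H) ≅ ins j e (colour c b H)
    colour-ins-same c b j e H = ≅-pointwise slotwise
      where
      slotwise : ∀ i → colour (c [ j ≔ b ]) b (ins j e H) i ≡ ins j e (colour c b H) i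
      slotwise i with i ≟ j
      ... | yes refl rewrite dec-true (b Bool.≟ b) refl = refl
      ... | no _     = refl

    colour-ins-other : ∀ c {b b′} j e (H : Slots k) → H j ≡ nothing → b′ ≢ b →
      colour (c [ j ≔ b ]) b′ (ins j e H) ≅ colour c b′ H
    colour-ins-other c {b} {b′} j e H Hj≡∅ b′≢b = ≅-pointwise slotwise
      where
      slotwise : ∀ i → colour (c [ j ≔ b ]) b′ (ins j e H) i ≡ colour c b′ H i
      slotwise i with i ≟ j
      ... | yes refl rewrite dec-false (b Bool.≟ b′) (b′≢b ∘ sym) | Hj≡∅ with does (c i Bool.≟ b′)
      ...   | true  = refl
      ...   | false = refl
      slotwise i | no _ = refl

    colour-isolated : ∀ c b v (H : Slots k) → Isolated v H → Isolated v (colour c b H)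
    colour-isolated c b v H iso j with does (c j Bool.≟ b)
    ... | true  = iso j
    ... | false = refl

    Decomposition : Slots k → Set
    Decomposition H = Σ (Fin k → Bool) λ c → ∀ b → Sparse₁₁ (colour c b H)

    decomposition-≅ : {H H′ : Slots k} → H ≅ H′ → Decomposition H′ → Decomposition H
    decomposition-≅ {H} {H′} H≅H′ (c , forests) =
      c , λ b → Sparse₁₁-⊑ (≅⇒⊑ (colour-≅ c b H≅H′)) (forests b)

  ─-self : ∀ X v → (X ─ v) v ≡ false
  ─-self X v rewrite dec-true (v ≟ v) refl = ∧-zeroʳ (X v)

  ─-other : ∀ X {v u} → u ≢ v → (X ─ v) u ≡ X u
  ─-other X {v} {u} u≢v rewrite dec-false (u ≟ v) u≢v = ∧-identityʳ (X u)

  count-─ : ∀ X v → X v ≡ true → count X ≡ suc (count (X ─ v))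
  count-─ X v Xv rewrite count-split X v | Xv = cong suc (count-cong same)
    where
    same : ∀ u → (X [ v ≔ false ]) u ≡ (X ─ v) u
    same u with u ≟ v
    ... | yes refl = sym (∧-zeroʳ (X u))
    ... | no _     = sym (∧-identityʳ (X u))

  count-─-≤ : ∀ X v → count (X ─ v) ≤ count X
  count-─-≤ X v = count-mono (X ─ v) X (λ u → ∧-conicalˡ (X u) _)

  induced-isolated : ∀ {k v} (H : Slots k) → Isolated v H → ∀ X → induced H X ≡ induced H (X ─ v)
  induced-isolated {v = v} H iso X = count-cong (λ j → spans-isolated (H j) (iso j))
    where
    spans-isolated : ∀ e → touches v e ≡ false → spans X e ≡ spans (X ─ v) e
    spans-isolated nothing        _ = refl
    spans-isolated (just (p , q)) _ with does (p ≟ v) | does (q ≟ v)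
    spans-isolated (just (p , q)) () | true  | _
    spans-isolated (just (p , q)) () | false | true
    ... | false | false = sym (cong₂ _∧_ (∧-identityʳ (X p)) (∧-identityʳ (X q)))

  Loopless : ∀ {k} → Slots k → Set
  Loopless H = ∀ j p q → H j ≡ just (p , q) → p ≢ q

  Sparse₂₂⇒loopless : ∀ {k} (H : Slots k) → Sparse₂₂ H → Loopless H
  Sparse₂₂⇒loopless H sparse j p .p Hj refl = <⇒≱ (s≤s (s≤s (s≤s z≤n))) (begin
    3                     ≤⟨ +-monoˡ-≤ 2 loop-spanned ⟩
    induced H ⁅ p ⁆ + 2   ≤⟨ sparse ⁅ p ⁆ (≤-reflexive (sym (count-singleton p))) ⟩
    2 * count ⁅ p ⁆       ≡⟨ cong (2 *_) (count-singleton p) ⟩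
    2                     ∎)
    where
    p∈⁅p⁆ : ⁅ p ⁆ p ≡ true
    p∈⁅p⁆ = dec-true (p ≟ p) refl
    open ≤-Reasoning
    loop-spanned : 1 ≤ induced H ⁅ p ⁆
    loop-spanned = count-pos _ j (trans (cong (spans ⁅ p ⁆) Hj) (cong₂ _∧_ p∈⁅p⁆ p∈⁅p⁆))

  pendant : ∀ {k v a j} (F : Slots k) → Sparse₁₁ F → Isolated v F → F j ≡ nothing → a ≢ v →
    Sparse₁₁ (ins j (v , a) F)
  pendant {v = v} {a} {j} F forest iso Fj≡∅ a≢v X X≢∅
    rewrite induced-ins j (v , a) F Fj≡∅ X with X v in Xv | X a in Xa
  ... | false | _     = forest X X≢∅
  ... | true  | false = forest X X≢∅
  ... | true  | true  = begin
    suc (induced F X + 1)      ≡⟨ cong (λ t → suc (t + 1)) (induced-isolated {v = v} F iso X) ⟩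
    suc (induced F Y + 1)      ≤⟨ s≤s (forest Y (count-pos Y a (trans (─-other X a≢v) Xa))) ⟩
    suc (count Y)              ≡⟨ count-─ X v Xv ⟨
    count X                    ∎
    where
    open ≤-Reasoning
    Y = X ─ v

  subdivision : ∀ {k v a b j j′} (F : Slots k) → Sparse₁₁ (just (a , b) ∷ F) → Isolated v F →
    j ≢ j′ → F j ≡ nothing → F j′ ≡ nothing → a ≢ v → b ≢ v →
    Sparse₁₁ (ins j (v , a) (ins j′ (v , b) F))
  subdivision {v = v} {a} {b} {j} {j′} F forest iso j≢j′ Fj≡∅ Fj′≡∅ a≢v b≢v X X≢∅ =
    subst (λ t → t + 1 ≤ count X) (sym new-edges) (bound (X v) refl)
    where
    new-edges : induced (ins j (v , a) (ins j′ (v , b) F)) X ≡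
                bit (X v ∧ X a) + (bit (X v ∧ X b) + induced F X)
    new-edges = trans (induced-ins j (v , a) (ins j′ (v , b) F) (trans (update-other F _ j≢j′) Fj≡∅) X)
                      (cong (bit (X v ∧ X a) +_) (induced-ins j′ (v , b) F Fj′≡∅ X))
    Y = X ─ v
    -- one edge ab of a forest is traded for the two edges va, vb
    two-for-one : ∀ x y i → bit x + (bit y + i) ≤ bit (x ∧ y) + i + 1
    two-for-one true  true  i = ≤-reflexive (cong suc (+-comm 1 i))
    two-for-one true  false i = ≤-reflexive (+-comm 1 i)
    two-for-one false true  i = ≤-reflexive (+-comm 1 i)
    two-for-one false false i = m≤m+n i 1
    without-v : bit (Y a) + (bit (Y b) + induced F Y) ≤ count Y
    without-v with count Y in #Y
    ... | zero rewrite count-zero Y #Y a | count-zero Y #Y b | induced-∅ F Y #Y = z≤n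
    ... | suc _ = ≤-trans (two-for-one (Y a) (Y b) (induced F Y))
                          (≤-trans (forest Y (≤-trans (s≤s z≤n) (≤-reflexive (sym #Y)))) (≤-reflexive #Y))
    bound : ∀ x → X v ≡ x → bit (x ∧ X a) + (bit (x ∧ X b) + induced F X) + 1 ≤ count X
    bound false _  = ≤-trans (+-monoˡ-≤ 1 (m≤n+m (induced F X) _)) (forest X X≢∅)
    bound true  Xv = begin
      bit (X a) + (bit (X b) + induced F X) + 1
        ≡⟨ cong₂ (λ s t → bit s + (bit t + induced F X) + 1) (─-other X a≢v) (─-other X b≢v) ⟨
      bit (Y a) + (bit (Y b) + induced F X) + 1
        ≡⟨ cong (λ t → bit (Y a) + (bit (Y b) + t) + 1) (induced-isolated {v = v} F iso X) ⟩
      bit (Y a) + (bit (Y b) + induced F Y) + 1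
        ≤⟨ +-monoˡ-≤ 1 without-v ⟩
      count Y + 1
        ≡⟨ +-comm (count Y) 1 ⟩
      suc (count Y)
        ≡⟨ count-─ X v Xv ⟨
      count X ∎
      where open ≤-Reasoning

  touches-edge : ∀ p q v → touches v (just (p , q)) ≡ ⁅ p ⁆ v ∨ ⁅ q ⁆ v
  touches-edge p q v with ⁅ p ⁆ v | ⁅ q ⁆ v
  ... | true  | _     = refl
  ... | false | true  = refl
  ... | false | false = refl

  touches-fst : ∀ p q → touches p (just (p , q)) ≡ true
  touches-fst p q = trans (touches-edge p q p) (cong (_∨ ⁅ q ⁆ p) (dec-true (p ≟ p) refl))

  touches-snd : ∀ p q → touches q (just (p , q)) ≡ true
  touches-snd p q = trans (touches-edge p q q) (trans (cong (⁅ p ⁆ q ∨_) (dec-true (q ≟ q) refl)) (∨-zeroʳ _))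

  endpoints : ∀ {p q} → p ≢ q → count (λ v → touches v (just (p , q))) ≡ 2
  endpoints {p} {q} p≢q = begin
    count (λ v → touches v (just (p , q)))
      ≡⟨ count-cong (touches-edge p q) ⟩
    count P∪Q
      ≡⟨ +-identityʳ _ ⟨
    count P∪Q + 0
      ≡⟨ cong (count P∪Q +_) (count-empty _ disjoint) ⟨
    count P∪Q + count (λ v → ⁅ p ⁆ v ∧ ⁅ q ⁆ v)
      ≡⟨ count-∨∧ ⁅ p ⁆ ⁅ q ⁆ ⟩
    count ⁅ p ⁆ + count ⁅ q ⁆
      ≡⟨ cong₂ _+_ (count-singleton p) (count-singleton q) ⟩
    2 ∎
    where
    open ≡-Reasoning
    P∪Q = λ v → ⁅ p ⁆ v ∨ ⁅ q ⁆ v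
    disjoint : ∀ v → ⁅ p ⁆ v ∧ ⁅ q ⁆ v ≡ false
    disjoint v with p ≟ v | q ≟ v
    ... | yes refl | yes refl = ⊥-elim (p≢q refl)
    ... | yes _    | no _     = refl
    ... | no _     | _        = refl

  handshake : ∀ {k} (H : Slots k) → Loopless H → sum (λ v → deg v H) ≡ 2 * size H
  handshake H loopless = begin
    sum (λ v → deg v H)                                  ≡⟨ ∑-comm (λ v j → bit (touches v (H j))) ⟩
    sum (λ j → count (λ v → touches v (H j)))            ≡⟨ sum-cong-≗ per-slot ⟩
    sum (λ j → 2 * bit (spans allV (H j)))               ≡⟨ *-distribˡ-sum 2 (bit ∘ spans allV ∘ H) ⟨
    2 * size H                                           ∎
    where
    open ≡-Reasoning
    per-slot : ∀ j → count (λ v → touches v (H j)) ≡ 2 * bit (spans allV (H j))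
    per-slot j with H j in Hj
    ... | nothing      = count-empty (λ v → touches v nothing) (λ _ → refl)
    ... | just (p , q) = endpoints (loopless j p q Hj)

  -- A nonempty (2,2)-sparse graph has a vertex of degree 1, 2 or 3: otherwise
  -- the non-isolated vertices P would satisfy 4|P| ≤ 2i(P) ≤ 4|P| − 4.
  low-degree-vertex : ∀ {k} (H : Slots k) → Sparse₂₂ H → 1 ≤ size H →
    Σ V λ v → 1 ≤ deg v H × deg v H ≤ 3
  low-degree-vertex H sparse nonempty with any? (λ v → (1 ≤? deg v H) ×-dec (deg v H ≤? 3))
  ... | yes found = found
  ... | no none   = ⊥-elim (m+1+n≰m (2 * size H) (begin
    2 * size H + 4         ≡⟨ *-distribˡ-+ 2 (size H) 2 ⟨
    2 * (size H + 2)       ≤⟨ *-monoʳ-≤ 2 P-sparse ⟩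
    2 * (2 * count P)      ≡⟨ *-assoc 2 2 (count P) ⟨
    4 * count P            ≤⟨ degrees-large ⟩
    2 * size H             ∎))
    where
    open ≤-Reasoning
    P : VSet
    P v = does (1 ≤? deg v H)
    endpoint-in-P : ∀ j {p q} → H j ≡ just (p , q) → P p ∧ P q ≡ true
    endpoint-in-P j {p} {q} Hj = cong₂ _∧_ (in-P p (touches-fst p q)) (in-P q (touches-snd p q))
      where
      in-P : ∀ u → touches u (just (p , q)) ≡ true → P u ≡ true
      in-P u touch = dec-true (1 ≤? deg u H) (count-pos _ j (trans (cong (touches u) Hj) touch))
    P-spans-all : induced H P ≡ size H
    P-spans-all = count-cong slotwise
      where
      slotwise : ∀ j → spans P (H j) ≡ spans allV (H j)
      slotwise j with H j in Hj
      ... | nothing = refl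
      ... | just _  = endpoint-in-P j Hj
    P-nonempty : 1 ≤ count P
    P-nonempty with count P in #P
    ... | zero  = ⊥-elim (<⇒≱ nonempty (≤-reflexive (trans (sym P-spans-all) (induced-∅ H P #P))))
    ... | suc _ = s≤s z≤n
    P-sparse : size H + 2 ≤ 2 * count P
    P-sparse = subst (λ t → t + 2 ≤ 2 * count P) P-spans-all (sparse P P-nonempty)
    large-or-zero : ∀ v → 4 * bit (P v) ≤ deg v H
    large-or-zero v with deg v H in #v
    ... | zero = z≤n
    ... | suc d with 3 ≤? d
    ...   | yes 3≤d = s≤s 3≤d
    ...   | no  3≰d = ⊥-elim (none (v , (≤-trans (s≤s z≤n) (≤-reflexive (sym #v))) ,
                                          ≤-trans (≤-reflexive #v) (s≤s (≤-pred (≰⇒> 3≰d)))))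
    degrees-large : 4 * count P ≤ 2 * size H
    degrees-large = begin
      4 * count P                ≡⟨ *-distribˡ-sum 4 (bit ∘ P) ⟩
      sum (λ v → 4 * bit (P v))  ≤⟨ sum-mono large-or-zero ⟩
      sum (λ v → deg v H)        ≡⟨ handshake H (Sparse₂₂⇒loopless H sparse) ⟩
      2 * size H                 ∎

  module _ {k : ℕ} where

    size-del : ∀ (H : Slots k) j → spans allV (H j) ≡ true → size H ≡ suc (size (del j H))
    size-del H j filled = trans (induced-del H j allV) (cong (λ b → bit b + size (del j H)) filled)

    reinsert : ∀ (H : Slots k) j e → (∀ X → spans X (H j) ≡ spans X (just e)) → H ≅ ins j e (del j H)
    reinsert H j e same = ≅-intro slotwise
      where
      slotwise : ∀ i X → spans X (H i) ≡ spans X (ins j e (del j H) i)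
      slotwise i X with i ≟ j
      ... | yes refl = same X
      ... | no _     = refl

    record Peel (H : Slots k) (v : V) (d : ℕ) : Set where
      field
        slot     : Fin k
        nbr      : V
        nbr≢v    : nbr ≢ v
        filled   : spans allV (H slot) ≡ true
        split    : H ≅ ins slot (v , nbr) (del slot H)
        deg-rest : deg v (del slot H) ≡ d

    deg-del : ∀ (H : Slots k) j v → touches v (H j) ≡ true → deg v H ≡ suc (deg v (del j H))
    deg-del H j v touch = trans (count-del (touches v) refl H j) (cong (λ b → bit b + deg v (del j H)) touch)

    peel : ∀ {v d} (H : Slots k) → Loopless H → deg v H ≡ suc d → Peel H v d
    peel {v} {d} H loopless deg≡ with any? (λ j → touches v (H j) Bool.≟ true)
    ... | no none = ⊥-elim (0≢1+n (trans (sym (count-empty _ (λ j → ¬-not (none ∘ (j ,_))))) deg≡))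
    ... | yes (j , touch) = from-edge (H j) refl touch
      where
      deg-rest : touches v (H j) ≡ true → deg v (del j H) ≡ d
      deg-rest touch′ = suc-injective (trans (sym (deg-del H j v touch′)) deg≡)
      from-edge : ∀ e → H j ≡ e → touches v e ≡ true → Peel H v d
      from-edge nothing        _  ()
      from-edge (just (p , q)) Hj touch with p ≟ v | q ≟ v
      ... | yes refl | _ = record
        { slot = j ; nbr = q ; nbr≢v = loopless j p q Hj ∘ sym ; filled = cong (spans allV) Hj
        ; split = reinsert H j (v , q) (λ X → cong (spans X) Hj)
        ; deg-rest = deg-rest (trans (cong (touches v) Hj) (touches-fst v q)) }
      ... | no _ | yes refl = record
        { slot = j ; nbr = p ; nbr≢v = loopless j p q Hj ; filled = cong (spans allV) Hj
        ; split = reinsert H j (v , p) (λ X → trans (cong (spans X) Hj) (∧-comm (X p) (X v)))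
        ; deg-rest = deg-rest (trans (cong (touches v) Hj) (touches-snd p v)) }
      ... | no _ | no _ = ⊥-elim (false≢true touch)

module TwoForests (N : ℕ) where
  open Multigraph N

  colour-empty : ∀ {k} c b (H : Slots k) {j} → H j ≡ nothing → colour c b H j ≡ nothing
  colour-empty c b H {j} Hj≡∅ with does (c j Bool.≟ b)
  ... | true  = Hj≡∅
  ... | false = refl

  add-to-class : ∀ {k} c b j e (H : Slots k) → H j ≡ nothing →
    Sparse₁₁ (colour c (not b) H) → Sparse₁₁ (ins j e (colour c b H)) →
    ∀ b′ → Sparse₁₁ (colour (c [ j ≔ b ]) b′ (ins j e H))
  add-to-class c b j e H Hj≡∅ other enlarged b′ with b′ Bool.≟ b
  ... | yes refl = Sparse₁₁-⊑ (≅⇒⊑ (colour-ins-same c b j e H)) enlarged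
  ... | no b′≢b  = Sparse₁₁-⊑ (≅⇒⊑ (colour-ins-other c j e H Hj≡∅ b′≢b))
                              (subst (λ x → Sparse₁₁ (colour c x H)) (sym (¬-not b′≢b)) other)

  add-pendant : ∀ {k} c b {j v a} (H : Slots k) → (∀ b′ → Sparse₁₁ (colour c b′ H)) →
    H j ≡ nothing → a ≢ v → Isolated v (colour c b H) →
    ∀ b′ → Sparse₁₁ (colour (c [ j ≔ b ]) b′ (ins j (v , a) H))
  add-pendant c b H forests Hj≡∅ a≢v iso =
    add-to-class c b _ _ H Hj≡∅ (forests (not b))
      (pendant (colour c b H) (forests b) iso (colour-empty c b H Hj≡∅) a≢v)

  colour-tail-⊑ : ∀ {k} (c : Fin (suc k) → Bool) x e (H : Slots k) → colour (c ∘ suc) x H ⊑ colour c x (e ∷ H)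
  colour-tail-⊑ c x e H = ⊑-intro (λ X → m≤n+m (induced (colour (c ∘ suc) x H) X) _)

  empty≢filled : ∀ {k} (H : Slots k) {j j′} → H j ≡ nothing → spans allV (H j′) ≡ true → j ≢ j′
  empty≢filled H Hj≡∅ filled refl = false≢true (trans (sym (cong (spans allV) Hj≡∅)) filled)

  del-at : ∀ {k} (H : Slots k) j → del j H j ≡ nothing
  del-at H j = update-at H j nothing

  Smaller : ∀ {k} → Slots k → Set
  Smaller H = ∀ {k′} (H′ : Slots k′) → size H′ < size H → Sparse₂₂ H′ → Decomposition H′

  -- v of degree 1: decompose H − v and add its edge as a pendant edge.
  degree-one : ∀ {k v} (H : Slots k) → Sparse₂₂ H → deg v H ≡ 1 → Smaller H → Decomposition H
  degree-one {v = v} H sparse deg≡1 smaller =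
    decomposition-≅ split (c [ slot ≔ true ] ,
      add-pendant c true H₁ forests (del-at H slot) nbr≢v (colour-isolated c true v H₁ isolated))
    where
    open Peel (peel H (Sparse₂₂⇒loopless H sparse) deg≡1)
    H₁ = del slot H
    isolated : Isolated v H₁
    isolated = count-zero _ deg-rest
    IH = smaller H₁ (≤-reflexive (sym (size-del H slot filled))) (Sparse₂₂-⊑ (del-⊑ H slot) sparse)
    c = proj₁ IH
    forests = proj₂ IH

  -- v has degree 2, with edges va, vb: decompose H − v, then va joins
  -- one class and vb the other, both as pendant edges.
  degree-two : ∀ {k v} (H : Slots k) → Sparse₂₂ H → deg v H ≡ 2 → Smaller H → Decomposition H
  degree-two {v = v} H sparse deg≡2 smaller =
    decomposition-≅ (≅-trans P₁.split (ins-≅ P₁.slot _ P₂.split))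
      (c₂ [ P₁.slot ≔ true ] ,
       add-pendant c₂ true H₂′ forests₂ H₂′-j₁ P₁.nbr≢v
         (Isolated-≅ (colour-ins-other c P₂.slot _ H₂ (del-at H₁ P₂.slot) (λ ()))
                     (colour-isolated c true v H₂ isolated)))
    where
    module P₁ = Peel (peel H (Sparse₂₂⇒loopless H sparse) deg≡2)
    H₁ = del P₁.slot H
    sparse₁ = Sparse₂₂-⊑ (del-⊑ H P₁.slot) sparse
    module P₂ = Peel (peel H₁ (Sparse₂₂⇒loopless H₁ sparse₁) P₁.deg-rest)
    H₂ = del P₂.slot H₁
    isolated : Isolated v H₂
    isolated = count-zero _ P₂.deg-rest
    size₂ : size H ≡ suc (suc (size H₂))
    size₂ = trans (size-del H P₁.slot P₁.filled) (cong suc (size-del H₁ P₂.slot P₂.filled))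
    IH = smaller H₂ (≤-trans (n≤1+n _) (≤-reflexive (sym size₂)))
                    (Sparse₂₂-⊑ (del-⊑ H₁ P₂.slot) sparse₁)
    c = proj₁ IH
    H₂′ = ins P₂.slot (v , P₂.nbr) H₂
    c₂ = c [ P₂.slot ≔ false ]
    forests₂ = add-pendant c false H₂ (proj₂ IH) (del-at H₁ P₂.slot) P₂.nbr≢v
                 (colour-isolated c false v H₂ isolated)
    j₁≢j₂ : P₁.slot ≢ P₂.slot
    j₁≢j₂ = empty≢filled H₁ (del-at H P₁.slot) P₂.filled
    H₂′-j₁ : H₂′ P₁.slot ≡ nothing
    H₂′-j₁ = trans (update-other H₂ _ j₁≢j₂) (trans (update-other H₁ nothing j₁≢j₂) (del-at H P₁.slot))

  _∪_ _∩_ : VSet → VSet → VSet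
  (X ∪ Y) u = X u ∨ Y u
  (X ∩ Y) u = X u ∧ Y u

  induced-supermodular : ∀ {k} (H : Slots k) X Y →
    induced H X + induced H Y ≤ induced H (X ∪ Y) + induced H (X ∩ Y)
  induced-supermodular H X Y = begin
    induced H X + induced H Y
      ≡⟨ ∑-distrib-+ (bit ∘ spans X ∘ H) (bit ∘ spans Y ∘ H) ⟨
    sum (λ j → bit (spans X (H j)) + bit (spans Y (H j)))
      ≤⟨ sum-mono (λ j → slotwise (H j)) ⟩
    sum (λ j → bit (spans (X ∪ Y) (H j)) + bit (spans (X ∩ Y) (H j)))
      ≡⟨ ∑-distrib-+ (bit ∘ spans (X ∪ Y) ∘ H) (bit ∘ spans (X ∩ Y) ∘ H) ⟩
    induced H (X ∪ Y) + induced H (X ∩ Y) ∎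
    where
    open ≤-Reasoning
    bits : ∀ x x′ y y′ →
      bit (x ∧ x′) + bit (y ∧ y′) ≤ bit ((x ∨ y) ∧ (x′ ∨ y′)) + bit ((x ∧ y) ∧ (x′ ∧ y′))
    bits true  true  true  true  = ≤-refl
    bits true  true  true  false = ≤-refl
    bits true  true  false true  = ≤-refl
    bits true  true  false false = ≤-refl
    bits true  false true  true  = ≤-refl
    bits true  false true  false = z≤n
    bits true  false false true  = z≤n
    bits true  false false false = z≤n
    bits false true  true  true  = ≤-refl
    bits false true  true  false = z≤n
    bits false true  false true  = z≤n
    bits false true  false false = z≤n
    bits false false true  true  = ≤-refl
    bits false false true  false = z≤n
    bits false false false true  = z≤n
    bits false false false false = z≤n
    slotwise : ∀ e → bit (spans X e) + bit (spans Y e) ≤ bit (spans (X ∪ Y) e) + bit (spans (X ∩ Y) e)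
    slotwise nothing        = z≤n
    slotwise (just (p , q)) = bits (X p) (X q) (Y p) (Y q)

  Tight : ∀ {k} → Slots k → VSet → Set
  Tight H X = 2 * count X ≤ induced H X + 2

  tight-union : ∀ {k} (H : Slots k) → Sparse₂₂ H → ∀ {X Y} → Tight H X → Tight H Y →
    1 ≤ count (X ∩ Y) → Tight H (X ∪ Y)
  tight-union H sparse {X} {Y} tight-X tight-Y meet = +-cancelʳ-≤ (2 * count (X ∩ Y)) _ _ (begin
    2 * count (X ∪ Y) + 2 * count (X ∩ Y)   ≡⟨ *-distribˡ-+ 2 (count (X ∪ Y)) _ ⟨
    2 * (count (X ∪ Y) + count (X ∩ Y))     ≡⟨ cong (2 *_) (count-∨∧ X Y) ⟩
    2 * (count X + count Y)                 ≡⟨ *-distribˡ-+ 2 (count X) _ ⟩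
    2 * count X + 2 * count Y               ≤⟨ +-mono-≤ tight-X tight-Y ⟩
    (iX + 2) + (iY + 2)                     ≡⟨ solve 2 (λ x y → x :+ con 2 :+ (y :+ con 2) := x :+ y :+ con 4) refl iX iY ⟩
    (iX + iY) + 4                           ≤⟨ +-monoˡ-≤ 4 (induced-supermodular H X Y) ⟩
    (iU + iI) + 4                           ≡⟨ solve 2 (λ u i → u :+ i :+ con 4 := u :+ con 2 :+ (i :+ con 2)) refl iU iI ⟩
    (iU + 2) + (iI + 2)                     ≤⟨ +-monoʳ-≤ (iU + 2) (sparse (X ∩ Y) meet) ⟩
    (iU + 2) + 2 * count (X ∩ Y)            ∎)
    where
    open ≤-Reasoning
    open +-*-Solver
    iX = induced H X
    iY = induced H Y
    iU = induced H (X ∪ Y)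
    iI = induced H (X ∩ Y)

  Through : V → V → V → VSet → Set
  Through v a b X = X v ≡ false × X a ≡ true × X b ≡ true

  Slack : ∀ {k} → Slots k → V → V → V → Set
  Slack H v a b = ∀ X → Through v a b X → induced H X + 3 ≤ 2 * count X

  tight-or-slack : ∀ {k} (H : Slots k) v a b → (Σ VSet λ X → Through v a b X × Tight H X) ⊎ Slack H v a b
  tight-or-slack H v a b
    with anySubset? (λ Xs → through? (lookup Xs) ×-dec (2 * count (lookup Xs) ≤? induced H (lookup Xs) + 2))
    where
    through? : ∀ X → Dec (Through v a b X)
    through? X = (X v Bool.≟ false) ×-dec (X a Bool.≟ true) ×-dec (X b Bool.≟ true)
  ... | yes (Xs , found) = inj₁ (lookup Xs , found)
  ... | no none = inj₂ slack
    where
    slack : Slack H v a b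
    slack X (Xv , Xa , Xb) with induced H X + 3 ≤? 2 * count X
    ... | yes ok = ok
    ... | no tight = ⊥-elim (none (tabulate X , (on-tab Xv , on-tab Xa , on-tab Xb) ,
          subst₂ (λ c i → 2 * c ≤ i + 2) (sym (count-cong (lookup∘tabulate X)))
                                         (sym (induced-cong H (lookup∘tabulate X)))
            (≤-pred (subst (suc (2 * count X) ≤_) (+-suc (induced H X) 2) (≰⇒> tight)))))
      where
      on-tab : ∀ {u β} → X u ≡ β → lookup (tabulate X) u ≡ β
      on-tab = trans (lookup∘tabulate X _)

  record Claw {k} (H : Slots k) (v : V) : Set where
    field
      ja jb jc : Fin k
      a b c    : V
      ja≢jb    : ja ≢ jb
      ja≢jc    : ja ≢ jc
      jb≢jc    : jb ≢ jc
      a≢v      : a ≢ v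
      b≢v      : b ≢ v
      c≢v      : c ≢ v
      base     : Slots k
      base-ja  : base ja ≡ nothing
      base-jb  : base jb ≡ nothing
      base-jc  : base jc ≡ nothing
      isolated : Isolated v base
      split    : H ≅ ins ja (v , a) (ins jb (v , b) (ins jc (v , c) base))

  claw : ∀ {k v} (H : Slots k) → Sparse₂₂ H → deg v H ≡ 3 → Claw H v
  claw {v = v} H sparse deg≡3 = record
    { ja = P₁.slot ; jb = P₂.slot ; jc = P₃.slot ; a = P₁.nbr ; b = P₂.nbr ; c = P₃.nbr
    ; ja≢jb = j₁≢j₂ ; ja≢jc = j₁≢j₃ ; jb≢jc = j₂≢j₃
    ; a≢v = P₁.nbr≢v ; b≢v = P₂.nbr≢v ; c≢v = P₃.nbr≢v
    ; base = H₃
    ; base-ja = trans (update-other H₂ nothing j₁≢j₃) H₂-j₁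
    ; base-jb = trans (update-other H₂ nothing j₂≢j₃) (del-at H₁ P₂.slot)
    ; base-jc = del-at H₂ P₃.slot
    ; isolated = count-zero _ P₃.deg-rest
    ; split = ≅-trans P₁.split (ins-≅ P₁.slot _ (≅-trans P₂.split (ins-≅ P₂.slot _ P₃.split)))
    }
    where
    module P₁ = Peel (peel H (Sparse₂₂⇒loopless H sparse) deg≡3)
    H₁ = del P₁.slot H
    sparse₁ = Sparse₂₂-⊑ (del-⊑ H P₁.slot) sparse
    module P₂ = Peel (peel H₁ (Sparse₂₂⇒loopless H₁ sparse₁) P₁.deg-rest)
    H₂ = del P₂.slot H₁
    sparse₂ = Sparse₂₂-⊑ (del-⊑ H₁ P₂.slot) sparse₁
    module P₃ = Peel (peel H₂ (Sparse₂₂⇒loopless H₂ sparse₂) P₂.deg-rest)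
    H₃ = del P₃.slot H₂
    j₁≢j₂ : P₁.slot ≢ P₂.slot
    j₁≢j₂ = empty≢filled H₁ (del-at H P₁.slot) P₂.filled
    H₂-j₁ : H₂ P₁.slot ≡ nothing
    H₂-j₁ = trans (update-other H₁ nothing j₁≢j₂) (del-at H P₁.slot)
    j₁≢j₃ : P₁.slot ≢ P₃.slot
    j₁≢j₃ = empty≢filled H₂ H₂-j₁ P₃.filled
    j₂≢j₃ : P₂.slot ≢ P₃.slot
    j₂≢j₃ = empty≢filled H₂ (del-at H₁ P₂.slot) P₃.filled

  swap-claw : ∀ {k v} {H : Slots k} → Claw H v → Claw H v
  swap-claw K = record
    { ja = ja ; jb = jc ; jc = jb ; a = a ; b = c ; c = b
    ; ja≢jb = ja≢jc ; ja≢jc = ja≢jb ; jb≢jc = jb≢jc ∘ sym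
    ; a≢v = a≢v ; b≢v = c≢v ; c≢v = b≢v
    ; base = base ; base-ja = base-ja ; base-jb = base-jc ; base-jc = base-jb
    ; isolated = isolated
    ; split = ≅-trans split (ins-≅ ja _ (ins-swap _ _ base jb≢jc))
    }
    where open Claw K

  module ClawFacts {k v} {H : Slots k} (K : Claw H v) where
    open Claw K

    claw-induced : ∀ X → induced H X ≡ bit (X v ∧ X a) + (bit (X v ∧ X b) + (bit (X v ∧ X c) + induced base X))
    claw-induced X = begin
      induced H X ≡⟨ induced-≅ split X ⟩
      induced (ins ja (v , a) (ins jb (v , b) (ins jc (v , c) base))) X
        ≡⟨ induced-ins ja (v , a) (ins jb (v , b) (ins jc (v , c) base))
             (trans (update-other (ins jc (v , c) base) _ ja≢jb) (trans (update-other base _ ja≢jc) base-ja)) X ⟩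
      bit (X v ∧ X a) + induced (ins jb (v , b) (ins jc (v , c) base)) X
        ≡⟨ cong (bit (X v ∧ X a) +_)
             (induced-ins jb (v , b) (ins jc (v , c) base) (trans (update-other base _ jb≢jc) base-jb) X) ⟩
      bit (X v ∧ X a) + (bit (X v ∧ X b) + induced (ins jc (v , c) base) X)
        ≡⟨ cong (λ t → bit (X v ∧ X a) + (bit (X v ∧ X b) + t)) (induced-ins jc _ base base-jc X) ⟩
      bit (X v ∧ X a) + (bit (X v ∧ X b) + (bit (X v ∧ X c) + induced base X)) ∎
      where open ≡-Reasoning

    induced-without-v : ∀ X → X v ≡ false → induced H X ≡ induced base X
    induced-without-v X Xv rewrite claw-induced X | Xv = refl

    size-claw : size H ≡ 3 + size base
    size-claw = claw-induced allV

    -- The va, vb, vc edges can be traded for an edge ab: a decomposition of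
    -- base + ab yields one of H, with ab subdivided by v in its class and
    -- vc added to the other class as a pendant edge.
    claw-decomposition : Decomposition (just (a , b) ∷ base) → Decomposition H
    claw-decomposition (c′ , forests′) = decomposition-≅ split (c₂ [ ja ≔ b₀ ] , classes)
      where
      b₀ = c′ zero
      col = c′ ∘ suc
      b₀≢not : b₀ ≢ not b₀
      b₀≢not = not-¬ refl
      base-forests : ∀ x → Sparse₁₁ (colour col x base)
      base-forests x = Sparse₁₁-⊑ (colour-tail-⊑ c′ x (just (a , b)) base) (forests′ x)
      ab-class : Sparse₁₁ (just (a , b) ∷ colour col b₀ base)
      ab-class = Sparse₁₁-⊑ (≅⇒⊑ (≅-pointwise at-slot)) (forests′ b₀)
        where
        at-slot : ∀ i → (just (a , b) ∷ colour col b₀ base) i ≡ colour c′ b₀ (just (a , b) ∷ base) i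
        at-slot zero    rewrite dec-true (b₀ Bool.≟ b₀) refl = refl
        at-slot (suc i) = refl
      H₁ = ins jc (v , c) base
      c₁ = col [ jc ≔ not b₀ ]
      forests₁ : ∀ x → Sparse₁₁ (colour c₁ x H₁)
      forests₁ = add-pendant col (not b₀) base base-forests base-jc c≢v (colour-isolated col (not b₀) v base isolated)
      H₂ = ins jb (v , b) H₁
      c₂ = c₁ [ jb ≔ b₀ ]
      H₁-jb : H₁ jb ≡ nothing
      H₁-jb = trans (update-other base _ jb≢jc) base-jb
      H₂-ja : H₂ ja ≡ nothing
      H₂-ja = trans (update-other H₁ _ ja≢jb) (trans (update-other base _ ja≢jc) base-ja)
      other : Sparse₁₁ (colour c₂ (not b₀) H₂)
      other = Sparse₁₁-⊑ (≅⇒⊑ (colour-ins-other c₁ jb _ H₁ H₁-jb (b₀≢not ∘ sym))) (forests₁ (not b₀))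
      subdivided : Sparse₁₁ (ins ja (v , a) (colour c₂ b₀ H₂))
      subdivided = Sparse₁₁-⊑
        (≅⇒⊑ (ins-≅ ja _ (≅-trans (colour-ins-same c₁ b₀ jb _ H₁)
                                   (ins-≅ jb _ (colour-ins-other col jc _ base base-jc b₀≢not)))))
        (subdivision (colour col b₀ base) ab-class (colour-isolated col b₀ v base isolated) ja≢jb
           (colour-empty col b₀ base base-ja) (colour-empty col b₀ base base-jb) a≢v b≢v)
      classes : ∀ x → Sparse₁₁ (colour (c₂ [ ja ≔ b₀ ]) x (ins ja (v , a) H₂))
      classes = add-to-class c₂ b₀ ja _ H₂ H₂-ja other subdivided

    split-off-sparse : Sparse₂₂ H → Slack H v a b → Sparse₂₂ (just (a , b) ∷ base)
    split-off-sparse sparse slack X X≢∅ = bound (X a ∧ X b) refl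
      where
      Y = X ─ v
      -- edges of base spanned by X are spanned by Y = X − v, and lie in H
      base-X : induced base X ≡ induced H Y
      base-X = trans (induced-isolated {v = v} base isolated X) (sym (induced-without-v Y (─-self X v)))
      shrink : 2 * count Y ≤ 2 * count X
      shrink = *-monoʳ-≤ 2 (count-─-≤ X v)
      bound : ∀ β → X a ∧ X b ≡ β → bit β + induced base X + 2 ≤ 2 * count X
      bound true  Xab rewrite base-X = begin
        suc (induced H Y + 2)   ≡⟨ +-suc (induced H Y) 2 ⟨
        induced H Y + 3         ≤⟨ slack Y (─-self X v , trans (─-other X a≢v) (∧-conicalˡ _ _ Xab)
                                                        , trans (─-other X b≢v) (∧-conicalʳ _ _ Xab)) ⟩
        2 * count Y             ≤⟨ shrink ⟩
        2 * count X             ∎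
        where open ≤-Reasoning
      bound false _ rewrite base-X with count Y in #Y
      ... | zero rewrite induced-∅ H Y #Y = *-monoʳ-≤ 2 X≢∅
      ... | suc _ = ≤-trans (sparse Y (≤-trans (s≤s z≤n) (≤-reflexive (sym #Y)))) shrink

    -- Tight sets X ∋ a, b and Y ∋ a, c avoiding v cannot coexist: their
    -- union U is tight, and U + v spans three more edges, violating sparsity.
    no-two-tight : Sparse₂₂ H → ∀ {X Y} → Through v a b X → Tight H X → Through v a c Y → Tight H Y → ⊥
    no-two-tight sparse {X} {Y} (Xv , Xa , Xb) tight-X (Yv , Ya , Yc) tight-Y = m+1+n≰m (iU + 4) too-many
      where
      open +-*-Solver
      U = X ∪ Y
      iU = induced H U
      tight-U : Tight H U
      tight-U = tight-union H sparse tight-X tight-Y (count-pos (X ∩ Y) a (cong₂ _∧_ Xa Ya))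
      W : VSet
      W u = U u ∨ ⁅ u ⁆ v
      Uv : U v ≡ false
      Uv = cong₂ _∨_ Xv Yv
      Wv : W v ≡ true
      Wv = trans (cong (U v ∨_) (dec-true (v ≟ v) refl)) (∨-zeroʳ (U v))
      W─v : ∀ u → (W ─ v) u ≡ U u
      W─v u with u ≟ v
      ... | yes refl = trans (∧-zeroʳ _) (sym Uv)
      ... | no _     = trans (∧-identityʳ _) (∨-identityʳ (U u))
      count-W : count W ≡ suc (count U)
      count-W = trans (count-─ W v Wv) (cong suc (count-cong W─v))
      W∋ : ∀ {u} → U u ≡ true → W u ≡ true
      W∋ {u} Uu = cong (_∨ ⁅ u ⁆ v) Uu
      induced-W : induced H W ≡ 3 + iU
      induced-W = begin
        induced H W
          ≡⟨ claw-induced W ⟩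
        bit (W v ∧ W a) + (bit (W v ∧ W b) + (bit (W v ∧ W c) + induced base W))
          ≡⟨ cong₂ (λ s t → bit (s ∧ t) + (bit (s ∧ W b) + (bit (s ∧ W c) + induced base W)))
                   Wv (W∋ (cong (_∨ Y a) Xa)) ⟩
        1 + (bit (W b) + (bit (W c) + induced base W))
          ≡⟨ cong₂ (λ s t → 1 + (bit s + (bit t + induced base W)))
                   (W∋ (cong (_∨ Y b) Xb)) (W∋ (trans (cong (X c ∨_) Yc) (∨-zeroʳ (X c)))) ⟩
        3 + induced base W
          ≡⟨ cong (3 +_) (induced-isolated {v = v} base isolated W) ⟩
        3 + induced base (W ─ v)
          ≡⟨ cong (3 +_) (induced-cong base W─v) ⟩
        3 + induced base U
          ≡⟨ cong (3 +_) (induced-without-v U Uv) ⟨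
        3 + iU ∎
        where open ≡-Reasoning
      too-many : iU + 4 + 1 ≤ iU + 4
      too-many = begin
        iU + 4 + 1          ≡⟨ solve 1 (λ u → u :+ con 4 :+ con 1 := con 3 :+ u :+ con 2) refl iU ⟩
        3 + iU + 2          ≡⟨ cong (_+ 2) induced-W ⟨
        induced H W + 2     ≤⟨ sparse W (count-pos W v Wv) ⟩
        2 * count W         ≡⟨ cong (2 *_) count-W ⟩
        2 * suc (count U)   ≡⟨ *-suc 2 (count U) ⟩
        2 + 2 * count U     ≤⟨ +-monoʳ-≤ 2 tight-U ⟩
        2 + (iU + 2)        ≡⟨ solve 1 (λ u → con 2 :+ (u :+ con 2) := u :+ con 4) refl iU ⟩
        iU + 4              ∎
        where open ≤-Reasoning

  -- v of degree 3: replace its three edges by an edge between two of its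
  -- neighbours; by no-two-tight, ab or ac keeps the graph (2,2)-sparse.
  degree-three : ∀ {k v} (H : Slots k) → Sparse₂₂ H → deg v H ≡ 3 → Smaller H → Decomposition H
  degree-three {v = v} H sparse deg≡3 smaller = from-claw (claw H sparse deg≡3)
    where
    reduce : (K : Claw H v) → Slack H v (Claw.a K) (Claw.b K) → Decomposition H
    reduce K slack = claw-decomposition (smaller (just (a , b) ∷ base) fewer (split-off-sparse sparse slack))
      where
      open Claw K
      open ClawFacts K
      fewer : 2 + size base ≤ size H
      fewer = ≤-trans (n≤1+n _) (≤-reflexive (sym size-claw))
    from-claw : Claw H v → Decomposition H
    from-claw K with tight-or-slack H v (Claw.a K) (Claw.b K) | tight-or-slack H v (Claw.a K) (Claw.c K)
    ... | inj₂ slack-ab | _             = reduce K slack-ab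
    ... | inj₁ _        | inj₂ slack-ac = reduce (swap-claw K) slack-ac
    ... | inj₁ (X , through-X , tight-X) | inj₁ (Y , through-Y , tight-Y) =
      ⊥-elim (ClawFacts.no-two-tight K sparse through-X tight-X through-Y tight-Y)

  edgeless-decomposition : ∀ {k} (H : Slots k) → size H ≡ 0 → Decomposition H
  edgeless-decomposition H size≡0 = (λ _ → true) , λ b →
    edgeless-forest (colour (λ _ → true) b H)
      (n≤0⇒n≡0 (≤-trans (induced-≤ (colour-⊑ (λ _ → true) b H) allV) (≤-reflexive size≡0)))

  two-forests : ∀ {k} (H : Slots k) → Sparse₂₂ H → Decomposition H
  two-forests H = go (size H) H ≤-refl
    where
    go : ∀ s {k} (H : Slots k) → size H ≤ s → Sparse₂₂ H → Decomposition H
    go zero    H size≤0 sparse = edgeless-decomposition H (n≤0⇒n≡0 size≤0)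
    go (suc s) H size≤s sparse with 1 ≤? size H
    ... | no  empty    = edgeless-decomposition H (n≤0⇒n≡0 (≤-pred (≰⇒> empty)))
    ... | yes nonempty = by-degree (proj₁ low) (proj₁ (proj₂ low)) (proj₂ (proj₂ low))
      where
      low = low-degree-vertex H sparse nonempty
      smaller : Smaller H
      smaller H′ fewer = go s H′ (≤-pred (≤-trans fewer size≤s))
      by-degree : ∀ v → 1 ≤ deg v H → deg v H ≤ 3 → Decomposition H
      by-degree v 1≤d d≤3 with deg v H in d
      ... | 1 = degree-one   H sparse d smaller
      ... | 2 = degree-two   H sparse d smaller
      ... | 3 = degree-three H sparse d smaller
      ... | suc (suc (suc (suc _))) = ⊥-elim (<⇒≱ (s≤s (s≤s (s≤s (s≤s z≤n)))) d≤3)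

module SpanningTrees {n m : ℕ} (G : Graph n m) where
  open Multigraph n

  edgesOf : (Fin m → Bool) → Slots m
  edgesOf P e = if P e then just (ends G e) else nothing

  slotsOf : Subset m → Slots m
  slotsOf S = edgesOf (lookup S)

  cycle-covered : ∀ {k} (vs : Fin (suc k) → V) → vs zero ≡ vs (fromℕ k) →
    ∀ i → image (vs ∘ suc) (vs (inject₁ i)) ≡ true
  cycle-covered {suc k} vs closed zero    =
    subst (λ u → image (vs ∘ suc) u ≡ true) (sym closed) (image-∋ (vs ∘ suc) (fromℕ k))
  cycle-covered {suc k} vs closed (suc i) = image-∋ (vs ∘ suc) (inject₁ i)

  -- A (1,1)-sparse edge set has no cycle: the k vertices of a cycle would
  -- span its k edges.
  acyclic : ∀ S → Sparse₁₁ (slotsOf S) → Acyclic G S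
  acyclic S forest cycle = m+1+n≰m (induced (slotsOf S) X) (begin
    induced (slotsOf S) X + 1   ≤⟨ forest X X≢∅ ⟩
    count X                     ≤⟨ count-image (vs ∘ suc) ⟩
    k                           ≤⟨ count-injection es esInj _ spanned ⟩
    induced (slotsOf S) X       ∎)
    where
    open Cycle cycle
    open ≤-Reasoning
    X = image (vs ∘ suc)
    X≢∅ : 1 ≤ count X
    X≢∅ = image-nonempty (vs ∘ suc) (≤-trans (s≤s z≤n) k≥2)
    spanned : ∀ i → spans X (slotsOf S (es i)) ≡ true
    spanned i rewrite []=⇒lookup (esIn i) with esJoin i
    ... | inj₁ e≡ rewrite e≡ = cong₂ _∧_ (cycle-covered vs closed i) (image-∋ (vs ∘ suc) i)
    ... | inj₂ e≡ rewrite e≡ = cong₂ _∧_ (image-∋ (vs ∘ suc) i) (cycle-covered vs closed i)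

  Closed : Subset m → VSet → Set
  Closed S C = ∀ e → lookup S e ≡ true → C (proj₁ (ends G e)) ≡ C (proj₂ (ends G e))

  record Component (S : Subset m) (u : V) : Set where
    field
      members : VSet
      has-u   : members u ≡ true
      walk    : ∀ w → members w ≡ true → Walk G S w u
      closed  : Closed S members

  -- Grow a set R ∋ u of vertices walking to u across edges of S leaving it;
  -- R gains a vertex each time, so with t ≥ n − |R| steps left R becomes closed.
  grow : ∀ S u (R : VSet) → R u ≡ true → (∀ w → R w ≡ true → Walk G S w u) →
    ∀ t → n ≤ count R + t → Component S u

  extend : ∀ S u (R : VSet) → R u ≡ true → (∀ w → R w ≡ true → Walk G S w u) →
    ∀ {e} → lookup S e ≡ true → ∀ w {x} → Joins G e w x → Walk G S x u → R w ≡ false →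
    ∀ t → n ≤ count R + t → Component S u
  extend S u R Ru walks Se w joins walk-x Rw zero bound =
    ⊥-elim (<⇒≱ (subst (_≤ n) (count-insert R w Rw) (count≤n (R [ w ≔ true ])))
                (subst (n ≤_) (+-identityʳ (count R)) bound))
  extend S u R Ru walks {e} Se w joins walk-x Rw (suc t) bound =
    grow S u (R [ w ≔ true ]) (trans (update-other R true u≢w) Ru) walks′ t
      (subst (n ≤_) (trans (+-suc (count R) t) (cong (_+ t) (sym (count-insert R w Rw)))) bound)
    where
    u≢w : u ≢ w
    u≢w refl = false≢true (trans (sym Rw) Ru)
    walks′ : ∀ w′ → (R [ w ≔ true ]) w′ ≡ true → Walk G S w′ u
    walks′ w′ R′w′ with w′ ≟ w
    ... | yes refl = cons e (lookup⇒[]= e S Se) joins walk-x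
    ... | no _     = walks w′ R′w′

  grow S u R Ru walks t bound
    with any? (λ e → (lookup S e Bool.≟ true) ×-dec ¬? (R (proj₁ (ends G e)) Bool.≟ R (proj₂ (ends G e))))
  ... | no none = record { members = R ; has-u = Ru ; walk = walks ; closed = closed }
    where
    closed : Closed S R
    closed e Se with R (proj₁ (ends G e)) Bool.≟ R (proj₂ (ends G e))
    ... | yes same  = same
    ... | no differ = ⊥-elim (none (e , Se , differ))
  ... | yes (e , Se , crossing) with R (proj₁ (ends G e)) in Rp | R (proj₂ (ends G e)) in Rq
  ...   | true  | true  = ⊥-elim (crossing refl)
  ...   | false | false = ⊥-elim (crossing refl)
  ...   | true  | false = extend S u R Ru walks Se (proj₂ (ends G e)) (inj₂ refl) (walks _ Rp) Rq t bound
  ...   | false | true  = extend S u R Ru walks Se (proj₁ (ends G e)) (inj₁ refl) (walks _ Rq) Rp t bound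

  closed-split : ∀ S C → Closed S C → size (slotsOf S) ≡ induced (slotsOf S) C + induced (slotsOf S) (not ∘ C)
  closed-split S C closed =
    trans (sum-cong-≗ slotwise) (∑-distrib-+ (bit ∘ spans C ∘ slotsOf S) (bit ∘ spans (not ∘ C) ∘ slotsOf S))
    where
    slotwise : ∀ e → bit (spans allV (slotsOf S e)) ≡ bit (spans C (slotsOf S e)) + bit (spans (not ∘ C) (slotsOf S e))
    slotwise e with lookup S e in Se
    ... | false = refl
    ... | true rewrite closed e Se with C (proj₂ (ends G e))
    ...   | true  = refl
    ...   | false = refl

  -- A (1,1)-sparse edge set with at least n − 1 edges is connected:
  -- otherwise the component C of v and its complement D are nonempty and
  -- closed, so |S| = i(C) + i(D) ≤ (|C| − 1) + (|D| − 1) = n − 2.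
  connected : ∀ S → Sparse₁₁ (slotsOf S) → n ≤ size (slotsOf S) + 1 → Connected G S
  connected S forest enough u v = reach (grow S v ⁅ v ⁆ (dec-true (v ≟ v) refl) start n start-bound)
    where
    start : ∀ w → ⁅ v ⁆ w ≡ true → Walk G S w v
    start w v∈ with v ≟ w
    ... | yes refl = nil
    start w () | no _
    start-bound : n ≤ count ⁅ v ⁆ + n
    start-bound = subst (λ c → n ≤ c + n) (sym (count-singleton v)) (n≤1+n n)
    reach : Component S v → Walk G S u v
    reach component with Component.members component u in Cu
    ... | true  = Component.walk component u Cu
    ... | false = ⊥-elim (m+1+n≰m (size (slotsOf S) + 1) (begin
      size (slotsOf S) + 1 + 1     ≡⟨ cong (λ t → t + 1 + 1) (closed-split S C (Component.closed component)) ⟩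
      iC + iD + 1 + 1              ≡⟨ solve 2 (λ c d → c :+ d :+ con 1 :+ con 1 := c :+ con 1 :+ (d :+ con 1)) refl iC iD ⟩
      (iC + 1) + (iD + 1)          ≤⟨ +-mono-≤ (forest C (count-pos C v (Component.has-u component)))
                                               (forest (not ∘ C) (count-pos (not ∘ C) u (cong not Cu))) ⟩
      count C + count (not ∘ C)    ≡⟨ count-complement C ⟩
      n                            ≤⟨ enough ⟩
      size (slotsOf S) + 1         ∎))
      where
      open ≤-Reasoning
      open +-*-Solver
      C = Component.members component
      iC = induced (slotsOf S) C
      iD = induced (slotsOf S) (not ∘ C)

  spanning-tree : ∀ S → Sparse₁₁ (slotsOf S) → n ≤ size (slotsOf S) + 1 → SpanningTree G S
  spanning-tree S forest enough = connected S forest enough , acyclic S forest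

∣∣≡count : ∀ {k} (S : Subset k) → ∣ S ∣ ≡ count (lookup S)
∣∣≡count Vec.[]          = refl
∣∣≡count (true Vec.∷ S)  = cong suc (∣∣≡count S)
∣∣≡count (false Vec.∷ S) = ∣∣≡count S

module Rigidity {n m : ℕ} (G : Graph n m) where
  open import Data.Fin.Subset using (_∩_)
  open Multigraph n
  open TwoForests n using (two-forests)
  open SpanningTrees G

  size-edgesOf : ∀ P → size (edgesOf P) ≡ count P
  size-edgesOf P = count-cong slotwise
    where
    slotwise : ∀ e → spans allV (edgesOf P e) ≡ P e
    slotwise e with P e
    ... | true  = refl
    ... | false = refl

  iSub≡induced : ∀ F X → iSub G F X ≡ induced (slotsOf F) (lookup X)
  iSub≡induced F X = trans (∣∣≡count (F ∩ inducedEdges G X)) (count-cong slotwise)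
    where
    slotwise : ∀ e → lookup (F ∩ inducedEdges G X) e ≡ spans (lookup X) (slotsOf F e)
    slotwise e rewrite lookup-zipWith _∧_ e F (inducedEdges G X)
                     | lookup∘tabulate (λ e → lookup X (proj₁ (ends G e)) ∧ lookup X (proj₂ (ends G e))) e
      with lookup F e
    ... | true  = refl
    ... | false = refl

  -- Since G has no loops, a single vertex spans no edge.
  small-spans-nothing : ∀ P X → count X ≤ 1 → induced (edgesOf P) X ≡ 0
  small-spans-nothing P X #X≤1 = count-empty _ slotwise
    where
    slotwise : ∀ e → spans X (edgesOf P e) ≡ false
    slotwise e with P e
    ... | false = refl
    ... | true with X (proj₁ (ends G e)) in Xp | X (proj₂ (ends G e)) in Xq
    ...   | true  | true  = ⊥-elim (<⇒≱ (s≤s #X≤1) (count-two X (noLoop G e) Xp Xq))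
    ...   | true  | false = refl
    ...   | false | _     = refl

  rigid-count : ∀ n → 2 ≤ n → suc (2 * n ∸ 3) ≡ 2 * (n ∸ 1)
  rigid-count (suc (suc k)) (s≤s (s≤s z≤n)) = begin
    suc (2 * suc (suc k) ∸ 3)   ≡⟨ cong (λ t → suc (t ∸ 3)) (*-suc 2 (suc k)) ⟩
    suc (2 * suc k ∸ 1)         ≡⟨ cong (λ t → suc (t ∸ 1)) (*-suc 2 k) ⟩
    2 + 2 * k                   ≡⟨ *-suc 2 k ⟨
    2 * suc k                   ∎
    where open ≡-Reasoning

  extra-edge : ∀ F → 2 ≤ n → ∣ F ∣ ≡ 2 * n ∸ 3 → m ≥ 2 * (n ∸ 1) →
    Σ (Fin m) λ e₀ → lookup F e₀ ≡ false
  extra-edge F 2≤n |F| m≥ with any? (λ e → lookup F e Bool.≟ false)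
  ... | yes found = found
  ... | no  none  = ⊥-elim (<⇒≱ F<m (≤-reflexive m≡F))
    where
    m≡F : m ≡ ∣ F ∣
    m≡F = trans (sym count-all) (trans (count-cong (λ e → sym (¬-not (none ∘ (e ,_))))) (sym (∣∣≡count F)))
    F<m : ∣ F ∣ < m
    F<m = subst (_≤ m) (sym (trans (cong suc |F|) (rigid-count n 2≤n))) m≥

  few-vertices : n ≤ 1 →
    Σ (Subset m) λ S → Σ (Subset m) λ T → SpanningTree G S × SpanningTree G T × Disjoint G S T
  few-vertices n≤1 = ∅ , ∅ , empty-tree , empty-tree , λ (e , e∈) → ∉⊥ (proj₁ (x∈p∩q⁻ ∅ ∅ e∈))
    where
    no-edges : size (slotsOf ∅) ≡ 0
    no-edges = trans (size-edgesOf (lookup ∅)) (count-empty (lookup (∅ {m})) (λ e → lookup-replicate e false))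
    empty-tree : SpanningTree G ∅
    empty-tree = spanning-tree ∅ (edgeless-forest (slotsOf ∅) no-edges) (subst (λ t → n ≤ t + 1) (sym no-edges) n≤1)

  module Augmented (F : Subset m) (F-sparse : Sparse G F) (e₀ : Fin m) (e₀∉F : lookup F e₀ ≡ false) where

    F⁺ : Fin m → Bool
    F⁺ = lookup F [ e₀ ≔ true ]

    H : Slots m
    H = edgesOf F⁺

    H≅F+e₀ : H ≅ ins e₀ (ends G e₀) (slotsOf F)
    H≅F+e₀ = ≅-pointwise slotwise
      where
      slotwise : ∀ e → H e ≡ ins e₀ (ends G e₀) (slotsOf F) e
      slotwise e with e ≟ e₀
      ... | yes refl = refl
      ... | no _     = refl

    induced-H : ∀ X → induced H X ≡ bit (spans X (just (ends G e₀))) + induced (slotsOf F) X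
    induced-H X = trans (induced-≅ H≅F+e₀ X) (induced-ins e₀ (ends G e₀) _ F-e₀ X)
      where
      F-e₀ : slotsOf F e₀ ≡ nothing
      F-e₀ rewrite e₀∉F = refl

    size-H : size H ≡ suc ∣ F ∣
    size-H = trans (induced-H allV) (cong suc (trans (size-edgesOf (lookup F)) (sym (∣∣≡count F))))

    F-bound : ∀ X → 2 ≤ count X → induced (slotsOf F) X ≤ 2 * count X ∸ 3
    F-bound X 2≤#X = subst₂ (λ i c → i ≤ 2 * c ∸ 3) frozen-i frozen-c
                       (F-sparse (tabulate X) (subst (2 ≤_) (sym frozen-c) 2≤#X))
      where
      frozen-i : iSub G F (tabulate X) ≡ induced (slotsOf F) X
      frozen-i = trans (iSub≡induced F (tabulate X)) (induced-cong (slotsOf F) (lookup∘tabulate X))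
      frozen-c : ∣ tabulate X ∣ ≡ count X
      frozen-c = trans (∣∣≡count (tabulate X)) (count-cong (lookup∘tabulate X))

    H-sparse : Sparse₂₂ H
    H-sparse X X≢∅ with count X ≤? 1
    ... | yes #X≤1 rewrite small-spans-nothing F⁺ X #X≤1 = *-monoʳ-≤ 2 X≢∅
    ... | no  #X≰1 = begin
      induced H X + 2                                    ≡⟨ cong (_+ 2) (induced-H X) ⟩
      bit (spans X (just (ends G e₀))) + iF + 2          ≤⟨ +-monoˡ-≤ 2 (+-mono-≤ (bit≤1 _) (F-bound X 2≤#X)) ⟩
      1 + (2 * count X ∸ 3) + 2                          ≡⟨ cong suc (+-comm (2 * count X ∸ 3) 2) ⟩
      3 + (2 * count X ∸ 3)                              ≡⟨ m+[n∸m]≡n 3≤2#X ⟩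
      2 * count X                                        ∎
      where
      open ≤-Reasoning
      iF = induced (slotsOf F) X
      2≤#X : 2 ≤ count X
      2≤#X = ≰⇒> #X≰1
      3≤2#X : 3 ≤ 2 * count X
      3≤2#X = ≤-trans (s≤s (s≤s (s≤s z≤n))) (*-monoʳ-≤ 2 2≤#X)
      bit≤1 : ∀ b → bit b ≤ 1
      bit≤1 true  = ≤-refl
      bit≤1 false = z≤n

    module Classes (c : Fin m → Bool) (forests : ∀ b → Sparse₁₁ (colour c b H)) where

      class : Bool → Subset m
      class b = tabulate (λ e → F⁺ e ∧ does (c e Bool.≟ b))

      class≅ : ∀ b → slotsOf (class b) ≅ colour c b H
      class≅ b = ≅-pointwise slotwise
        where
        slotwise : ∀ e → slotsOf (class b) e ≡ colour c b H e
        slotwise e rewrite lookup∘tabulate (λ e → F⁺ e ∧ does (c e Bool.≟ b)) e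
          with F⁺ e | does (c e Bool.≟ b)
        ... | true  | true  = refl
        ... | true  | false = refl
        ... | false | true  = refl
        ... | false | false = refl

      class-forest : ∀ b → Sparse₁₁ (slotsOf (class b))
      class-forest b = Sparse₁₁-⊑ (≅⇒⊑ (class≅ b)) (forests b)

      edges : Bool → ℕ
      edges b = size (slotsOf (class b))

      class-sizes : edges true + edges false ≡ size H
      class-sizes = trans (cong₂ _+_ (induced-≅ (class≅ true) allV) (induced-≅ (class≅ false) allV))
                          (colour-split c H allV)

      class-small : 1 ≤ n → ∀ b → edges b + 1 ≤ n
      class-small 1≤n b = subst (edges b + 1 ≤_) count-all (class-forest b allV (subst (1 ≤_) (sym count-all) 1≤n))

      in-class : ∀ b e → lookup (class b) e ≡ true → c e ≡ b
      in-class b e e∈ with c e Bool.≟ b | trans (sym (lookup∘tabulate (λ e → F⁺ e ∧ does (c e Bool.≟ b)) e)) e∈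
      ... | yes c≡b | _       = c≡b
      ... | no _    | F∧false = ⊥-elim (false≢true (trans (sym (∧-zeroʳ (F⁺ e))) F∧false))

      classes-disjoint : Disjoint G (class true) (class false)
      classes-disjoint (e , e∈) with x∈p∩q⁻ (class true) (class false) e∈
      ... | e∈t , e∈f =
        false≢true (trans (sym (in-class false e ([]=⇒lookup e∈f))) (in-class true e ([]=⇒lookup e∈t)))

    -- With |F| = 2n − 3 the two forests have 2n − 2 edges together, hence
    -- n − 1 each: they are spanning trees.
    two-trees : 2 ≤ n → ∣ F ∣ ≡ 2 * n ∸ 3 →
      Σ (Subset m) λ S → Σ (Subset m) λ T → SpanningTree G S × SpanningTree G T × Disjoint G S T
    two-trees 2≤n |F| = class true , class false ,
      spanning-tree (class true)  (class-forest true)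
        (at-least (edges true) (edges false) n total (class-small 1≤n false)) ,
      spanning-tree (class false) (class-forest false)
        (at-least (edges false) (edges true) n (trans (+-comm (edges false) (edges true)) total) (class-small 1≤n true)) ,
      classes-disjoint
      where
      decomposition = two-forests H H-sparse
      open Classes (proj₁ decomposition) (proj₂ decomposition)
      1≤n : 1 ≤ n
      1≤n = ≤-trans (s≤s z≤n) 2≤n
      total : edges true + edges false ≡ 2 * (n ∸ 1)
      total = trans class-sizes (trans size-H (trans (cong suc |F|) (rigid-count n 2≤n)))
      at-least : ∀ a b k → a + b ≡ 2 * (k ∸ 1) → b + 1 ≤ k → k ≤ a + 1
      at-least a b zero    _   b<0 = ⊥-elim (<⇒≱ (s≤s z≤n) (subst (_≤ 0) (+-comm b 1) b<0))
      at-least a b (suc k) a+b b<k = subst (suc k ≤_) (+-comm 1 a) (s≤s (+-cancelʳ-≤ k k a (begin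
        k + k     ≡⟨ cong (k +_) (+-identityʳ k) ⟨
        2 * k     ≡⟨ a+b ⟨
        a + b     ≤⟨ +-monoʳ-≤ a (≤-pred (subst (_≤ suc k) (+-comm b 1) b<k)) ⟩
        a + k     ∎)))
        where open ≤-Reasoning

mainTheorem7 : ∀ {n m : ℕ} (G : Graph n m) → Rigid G → m ≥ 2 * (n ∸ 1) →
    Σ (Subset m) λ S → Σ (Subset m) λ T →
      SpanningTree G S × SpanningTree G T × Disjoint G S T
mainTheorem7 {n} G (F , F-sparse , |F|) m≥ with n ≤? 1
... | yes n≤1 = Rigidity.few-vertices G n≤1
... | no  n≰1 = Rigidity.Augmented.two-trees G F F-sparse e₀ e₀∉F 2≤n |F|
  where
  2≤n : 2 ≤ n
  2≤n = ≰⇒> n≰1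
  extra = Rigidity.extra-edge G F 2≤n |F| m≥
  e₀ = proj₁ extra
  e₀∉F = proj₂ extra
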